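{- The intersection rewrite rules listed in the context are terminating: starting from any finite set $C$ of normalized variable bounds that is simultaneously satisfied by a consistent reference vector $\vec{v}$, every sequence of applications of these rules is finite.
   Context: Variables $x_1,\dots,x_n$ are each of integer or rational type; the index $k$ of $x_k$ is its dimension. A polynomial is a linear expression $c_nx_n+\cdots+c_1x_1+c_0$ with rational $c_i$; its dimension is the largest $k$ with $c_k\neq 0$ (constants have dimension $0$). A vector $\vec{v}=(v_n,\dots,v_1)$ assigns a value to each variable; it is consistent if each $v_i$ has the type of $x_i$; $E[\vec{v}]$ denotes evaluation. The symbol $\prec$ stands for $<$ or $\le$, and $\succ$ for $>$ or $\ge$. A variable bound is a constraint $x_k\prec P$, $P\prec x_k$ (equivalently $x_k\succ P$), or $x_k=P$ with $P$ a polynomial; its dimension is $k$; it is normalized if $\dim(P)<k$. The normalization $\langle L\rangle$ of a linear relation $L$ that is true at $\vec{v}$ is obtained as follows: rewrite $P_i\prec P_j$ as $P_i-P_j\prec 0$, $P_i\succ P_j$ as $P_j-P_i\prec 0$, $P_i=P_j$ as $P_i-P_j=0$; if the resulting polynomial is a (true) constant, the result is the empty set of bounds; otherwise, writing it as $P_k$ with leading coefficient $c_k$, $P_k<0$ becomes $x_k< -(P_k/c_k-x_k)$ if $c_k>0$ and $-(P_k/c_k-x_k)<x_k$ if $c_k<0$, similarly for $\le$, and $P_k=0$ becomes $x_k=-(P_k/c_k-x_k)$; the result is the set containing this single normalized bound. The rules act on an unordered set of bounds (so bounds may be arbitrarily reordered) and replace two bounds on the same variable $x_n$ by the right-hand side: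 (lt-int.1) $(x_n<P)\cap(x_n<Q)\to(x_n<P)\cap\langle P\le Q\rangle$ if $P[\vec v]\le Q[\vec v]$; (lt-int.2) $(x_n<P)\cap(x_n\le Q)\to(x_n<P)\cap\langle P\le Q\rangle$ if $P[\vec v]\le Q[\vec v]$; (lt-int.3) $(x_n\le P)\cap(x_n<Q)\to(x_n\le P)\cap\langle P<Q\rangle$ if $P[\vec v]<Q[\vec v]$; (lt-int.4) $(x_n\le P)\cap(x_n\le Q)\to(x_n\le P)\cap\langle P\le Q\rangle$ if $P[\vec v]\le Q[\vec v]$; the symmetric rules for two lower bounds: $(P<x_n)\cap(Q<x_n)\to(P<x_n)\cap\langle Q\le P\rangle$ if $Q[\vec v]\le P[\vec v]$; $(P<x_n)\cap(Q\le x_n)\to(P<x_n)\cap\langle Q\le P\rangle$ if $Q[\vec v]\le P[\vec v]$; $(P\le x_n)\cap(Q<x_n)\to(P\le x_n)\cap\langle Q<P\rangle$ if $Q[\vec v]<P[\vec v]$; $(P\le x_n)\cap(Q\le x_n)\to(P\le x_n)\cap\langle Q\le P\rangle$ if $Q[\vec v]\le P[\vec v]$; and the equality rules (eq-int.1) $(x_n=P)\cap(x_n\prec Q)\to(x_n=P)\cap\langle P\prec Q\rangle$; (eq-int.2) $(x_n=P)\cap(Q\prec x_n)\to(x_n=P)\cap\langle Q\prec P\rangle$; (eq-int.3) $(x_n=P)\cap(x_n=Q)\to(x_n=P)\cap\langle P=Q\rangle$. -}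

module Defs where

open import Data.Nat using (ℕ; zero; suc)
import Data.Nat as ℕ
open import Data.Fin using (Fin; zero; suc; toℕ)
open import Data.Bool using (Bool; true; false)
open import Data.Maybe using (Maybe; just; nothing)
open import Data.List using (List; []; _∷_; _++_)
open import Data.Vec using (Vec; []; _∷_; zipWith; map; foldr; lookup; updateAt)
import Data.Rational
open import Data.Rational using (ℚ; 0ℚ; 1ℚ; _+_; _*_; -_; _-_; 1/_; _≤_; _<_; _≟_; <-nonZero; >-nonZero)
open Data.Rational.ℚ using (denominatorℕ)
open import Data.Rational.Properties using (<-cmp)
open import Data.Product using (Σ; _×_; _,_)
open import Relation.Nullary using (yes; no)
open import Relation.Binary using (tri<; tri≈; tri>)
open import Relation.Binary.PropositionalEquality using (_≡_)
open import Data.List.Relation.Binary.Permutation.Propositional using (_↭_)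

-- Variables x₁ … x_N.  The Fin index i : Fin N stands for the variable
-- x_{toℕ i + 1}, whose dimension is toℕ i + 1.

-- Types of the variables: true = integer, false = rational.
VarTypes : ℕ → Set
VarTypes N = Vec Bool N

Valuation : ℕ → Set
Valuation N = Vec ℚ N

IsInteger : ℚ → Set
IsInteger q = denominatorℕ q ≡ 1

Consistent : ∀ {N} → VarTypes N → Valuation N → Set
Consistent {N} ty v = (i : Fin N) → lookup ty i ≡ true → IsInteger (lookup v i)

-- Polynomials c_N x_N + ... + c_1 x_1 + c_0 ;  coeffs = (c_1, …, c_N)

record Poly (N : ℕ) : Set where
  constructor poly
  field
    coeffs : Vec ℚ N
    const  : ℚ
open Poly public

eval : ∀ {N} → Poly N → Valuation N → ℚ
eval P v = foldr _ _+_ 0ℚ (zipWith _*_ (coeffs P) v) + const P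

_⊖_ : ∀ {N} → Poly N → Poly N → Poly N
P ⊖ Q = poly (zipWith _-_ (coeffs P) (coeffs Q)) (const P - const Q)

scale : ∀ {N} → ℚ → Poly N → Poly N
scale c P = poly (map (c *_) (coeffs P)) (c * const P)

negP : ∀ {N} → Poly N → Poly N
negP P = scale (- 1ℚ) P

addVar : ∀ {N} → Fin N → Poly N → Poly N
addVar i P = poly (updateAt (coeffs P) i (_+ 1ℚ)) (const P)

lead : ∀ {n} → Vec ℚ n → Maybe (Fin n)
lead [] = nothing
lead (c ∷ cs) with lead cs
... | just i = just (suc i)
... | nothing with c ≟ 0ℚ
...   | yes _ = nothing
...   | no _  = just zero

dim : ∀ {N} → Poly N → ℕ
dim P with lead (coeffs P)
... | nothing = 0
... | just i  = suc (toℕ i)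

data Cmp : Set where
  lt le : Cmp

data Kind : Set where
  upper : Cmp → Kind
  lower : Cmp → Kind
  equal : Kind

record Bound (N : ℕ) : Set where
  constructor bound
  field
    var  : Fin N
    kind : Kind
    rhs  : Poly N
open Bound public

bdim : ∀ {N} → Bound N → ℕ
bdim b = suc (toℕ (var b))

Normalized : ∀ {N} → Bound N → Set
Normalized b = dim (rhs b) ℕ.< bdim b

_⟦_⟧_ : ℚ → Cmp → ℚ → Set
a ⟦ lt ⟧ b = a < b
a ⟦ le ⟧ b = a ≤ b

Sat : ∀ {N} → Valuation N → Bound N → Set
Sat v (bound i (upper c) P) = lookup v i ⟦ c ⟧ eval P v
Sat v (bound i (lower c) P) = eval P v ⟦ c ⟧ lookup v i
Sat v (bound i equal P)     = lookup v i ≡ eval P v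

-- ⟨R ≺ 0⟩ : with k the leading index and c_k its coefficient, the bound on x_k
-- with right-hand side -(R/c_k - x_k) = x_k - R/c_k (upper if c_k > 0, lower if c_k < 0)
normLt0 : ∀ {N} → Cmp → Poly N → List (Bound N)
normLt0 c R with lead (coeffs R)
... | nothing = []
... | just k with <-cmp (lookup (coeffs R) k) 0ℚ
...   | tri< ck<0 _ _ = bound k (lower c)
                          (addVar k (negP (scale (1/_ (lookup (coeffs R) k) {{<-nonZero ck<0}}) R))) ∷ []
...   | tri≈ _ _ _    = []
...   | tri> _ _ ck>0 = bound k (upper c)
                          (addVar k (negP (scale (1/_ (lookup (coeffs R) k) {{>-nonZero ck>0}}) R))) ∷ []

normEq0 : ∀ {N} → Poly N → List (Bound N)
normEq0 R with lead (coeffs R)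
... | nothing = []
... | just k with <-cmp (lookup (coeffs R) k) 0ℚ
...   | tri< ck<0 _ _ = bound k equal
                          (addVar k (negP (scale (1/_ (lookup (coeffs R) k) {{<-nonZero ck<0}}) R))) ∷ []
...   | tri≈ _ _ _    = []
...   | tri> _ _ ck>0 = bound k equal
                          (addVar k (negP (scale (1/_ (lookup (coeffs R) k) {{>-nonZero ck>0}}) R))) ∷ []

⟨_⟦_⟧_⟩ : ∀ {N} → Poly N → Cmp → Poly N → List (Bound N)
⟨ P ⟦ c ⟧ Q ⟩ = normLt0 c (P ⊖ Q)

⟨_≐_⟩ : ∀ {N} → Poly N → Poly N → List (Bound N)
⟨ P ≐ Q ⟩ = normEq0 (P ⊖ Q)

-- The intersection rules: Rule v b₁ b₂ L  means
--   b₁ ∩ b₂  →  b₁ ∩ L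

data Rule {N : ℕ} (v : Valuation N) : Bound N → Bound N → List (Bound N) → Set where
  lt-int-1 : ∀ {i P Q} → eval P v ≤ eval Q v →
    Rule v (bound i (upper lt) P) (bound i (upper lt) Q) ⟨ P ⟦ le ⟧ Q ⟩
  lt-int-2 : ∀ {i P Q} → eval P v ≤ eval Q v →
    Rule v (bound i (upper lt) P) (bound i (upper le) Q) ⟨ P ⟦ le ⟧ Q ⟩
  lt-int-3 : ∀ {i P Q} → eval P v < eval Q v →
    Rule v (bound i (upper le) P) (bound i (upper lt) Q) ⟨ P ⟦ lt ⟧ Q ⟩
  lt-int-4 : ∀ {i P Q} → eval P v ≤ eval Q v →
    Rule v (bound i (upper le) P) (bound i (upper le) Q) ⟨ P ⟦ le ⟧ Q ⟩
  gt-int-1 : ∀ {i P Q} → eval Q v ≤ eval P v →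
    Rule v (bound i (lower lt) P) (bound i (lower lt) Q) ⟨ Q ⟦ le ⟧ P ⟩
  gt-int-2 : ∀ {i P Q} → eval Q v ≤ eval P v →
    Rule v (bound i (lower lt) P) (bound i (lower le) Q) ⟨ Q ⟦ le ⟧ P ⟩
  gt-int-3 : ∀ {i P Q} → eval Q v < eval P v →
    Rule v (bound i (lower le) P) (bound i (lower lt) Q) ⟨ Q ⟦ lt ⟧ P ⟩
  gt-int-4 : ∀ {i P Q} → eval Q v ≤ eval P v →
    Rule v (bound i (lower le) P) (bound i (lower le) Q) ⟨ Q ⟦ le ⟧ P ⟩
  eq-int-1 : ∀ {i P Q c} →
    Rule v (bound i equal P) (bound i (upper c) Q) ⟨ P ⟦ c ⟧ Q ⟩
  eq-int-2 : ∀ {i P Q c} →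
    Rule v (bound i equal P) (bound i (lower c) Q) ⟨ Q ⟦ c ⟧ P ⟩
  eq-int-3 : ∀ {i P Q} →
    Rule v (bound i equal P) (bound i equal Q) ⟨ P ≐ Q ⟩

-- One rewrite step on an unordered collection of bounds (list up to permutation).
Step : ∀ {N} → Valuation N → List (Bound N) → List (Bound N) → Set
Step {N} v C D =
  Σ (Bound N) λ b₁ → Σ (Bound N) λ b₂ → Σ (List (Bound N)) λ R → Σ (List (Bound N)) λ L →
    (C ↭ b₁ ∷ b₂ ∷ R) × Rule v b₁ b₂ L × (D ≡ b₁ ∷ L ++ R)

_◁[_]_ : ∀ {N} → List (Bound N) → Valuation N → List (Bound N) → Set
D ◁[ v ] C = Step v C D

module Submission where

-- Give every collection of bounds the weight  Σ dim(b)  (the sum of the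
-- dimensions of its bounds).  A rule replaces two bounds b₁, b₂ on the same
-- variable x_k by b₁ together with ⟨L⟩, where L compares the right-hand sides
-- of b₁ and b₂.  If b₁ and b₂ are normalized, these right-hand sides have
-- dimension < k, hence so does their difference, and ⟨L⟩ is either empty or a
-- single normalized bound on a variable x_j with j < k.  So the weight drops
-- from  dim b₁ + k + …  to at most  dim b₁ + (k - 1) + …, and normalization
-- is preserved.  The weight is a natural number, so the rewrite relation is
-- well founded on normalized collections.

open import Defs
open import Data.Nat using (ℕ)
open import Data.List using (List)
open import Data.List.Relation.Unary.All using (All)
open import Induction.WellFounded using (Acc)

open import Data.Nat using (zero; suc; z≤n; s≤s; s≤s⁻¹) renaming (_+_ to _+ℕ_; _≤_ to _≤ℕ_; _<_ to _<ℕ_)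
import Data.Nat.Properties as ℕ
open import Data.Nat.Induction using (<-wellFounded)
open import Data.Nat.ListAction using (sum)
open import Data.Nat.ListAction.Properties using (sum-↭; sum-++)
open import Data.Fin using (Fin; zero; suc; toℕ)
import Data.Fin as Fin
open import Data.Fin.Properties using (toℕ-injective)
open import Data.Maybe using (just; nothing)
open import Data.List using ([]; _∷_; _++_; map)
open import Data.List.Properties using (map-++)
open import Data.List.Relation.Unary.All using ([]; _∷_)
open import Data.List.Relation.Unary.All.Properties using (++⁺)
open import Data.List.Relation.Binary.Permutation.Propositional using (_↭_)
open import Data.List.Relation.Binary.Permutation.Propositional.Properties using (All-resp-↭; map⁺)
open import Data.Vec using (Vec; _∷_; lookup; updateAt) renaming (map to mapᵥ)
open import Data.Vec.Properties using (lookup-zipWith; lookup-map; lookup∘updateAt; lookup∘updateAt′)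
open import Data.Rational using (ℚ; 0ℚ; 1ℚ; _+_; _*_; -_; _-_; 1/_; _≟_; NonZero; <-nonZero; >-nonZero)
open import Data.Rational.Properties using (<-cmp; *-inverseˡ; *-zeroʳ)
open import Data.Product using (_×_; _,_; proj₁; proj₂)
open import Data.Empty using (⊥-elim)
open import Relation.Nullary using (Dec; yes; no; ¬_)
open import Relation.Binary using (tri<; tri≈; tri>)
open import Relation.Binary.PropositionalEquality using (_≡_; refl; sym; trans; cong; subst; module ≡-Reasoning)
open import Induction.WellFounded using (acc)

VanishFrom : ∀ {n} → ℕ → Vec ℚ n → Set
VanishFrom m cs = ∀ j → m ≤ℕ toℕ j → lookup cs j ≡ 0ℚ

lead-nothing : ∀ {n} (cs : Vec ℚ n) → lead cs ≡ nothing → ∀ j → lookup cs j ≡ 0ℚ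
lead-nothing (c ∷ cs) e j with lead cs in eq
lead-nothing (c ∷ cs) () j | just _
... | nothing with c ≟ 0ℚ
lead-nothing (c ∷ cs) e zero    | nothing | yes c≡0 = c≡0
lead-nothing (c ∷ cs) e (suc j) | nothing | yes c≡0 = lead-nothing cs eq j
lead-nothing (c ∷ cs) () j      | nothing | no _

lead-just : ∀ {n} (cs : Vec ℚ n) {k} → lead cs ≡ just k →
            ¬ lookup cs k ≡ 0ℚ × VanishFrom (suc (toℕ k)) cs
lead-just (c ∷ cs) e with lead cs in eq
lead-just (c ∷ cs) refl | just i =
  proj₁ (lead-just cs eq) , λ { zero () ; (suc j) (s≤s p) → proj₂ (lead-just cs eq) j p }
... | nothing with c ≟ 0ℚ
lead-just (c ∷ cs) ()   | nothing | yes _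
lead-just (c ∷ cs) refl | nothing | no c≢0 =
  c≢0 , λ { zero () ; (suc j) _ → lead-nothing cs eq j }

lead<-vanish : ∀ {n} (cs : Vec ℚ n) {m k} → VanishFrom m cs → lead cs ≡ just k → toℕ k <ℕ m
lead<-vanish cs {m} {k} z e with m ℕ.≤? toℕ k
... | yes m≤k = ⊥-elim (proj₁ (lead-just cs e) (z k m≤k))
... | no m≰k  = ℕ.≰⇒> m≰k

dim≤⇒vanish : ∀ {N} (P : Poly N) {m} → dim P ≤ℕ m → VanishFrom m (coeffs P)
dim≤⇒vanish P d with lead (coeffs P) in eq
... | nothing = λ j _ → lead-nothing (coeffs P) eq j
... | just k  = λ j m≤j → proj₂ (lead-just (coeffs P) eq) j (ℕ.≤-trans d m≤j)

vanish⇒dim≤ : ∀ {N} (P : Poly N) {m} → VanishFrom m (coeffs P) → dim P ≤ℕ m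
vanish⇒dim≤ P z with lead (coeffs P) in eq
... | nothing = z≤n
... | just k  = lead<-vanish (coeffs P) z eq

vanish-⊖ : ∀ {N} (P Q : Poly N) {m} → VanishFrom m (coeffs P) → VanishFrom m (coeffs Q) →
           VanishFrom m (coeffs (P ⊖ Q))
vanish-⊖ P Q zp zq j p
  rewrite lookup-zipWith _-_ j (coeffs P) (coeffs Q) | zp j p | zq j p = refl

-- The right-hand side produced by normalization: R = 0 solved for x_k,
-- i.e. x_k - R / c_k where c_k is the coefficient of x_k in R.
solveFor : ∀ {N} (R : Poly N) (k : Fin N) → NonZero (lookup (coeffs R) k) → Poly N
solveFor R k nz = addVar k (negP (scale (1/_ (lookup (coeffs R) k) {{nz}}) R))

negScale-entry : ∀ {n} (a : ℚ) (cs : Vec ℚ n) j →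
                 lookup (mapᵥ (- 1ℚ *_) (mapᵥ (a *_) cs)) j ≡ - 1ℚ * (a * lookup cs j)
negScale-entry a cs j = trans (lookup-map j (- 1ℚ *_) (mapᵥ (a *_) cs)) (cong (- 1ℚ *_) (lookup-map j (a *_) cs))

solveFor-vanish : ∀ {N} (R : Poly N) {k} → lead (coeffs R) ≡ just k →
                  (nz : NonZero (lookup (coeffs R) k)) →
                  VanishFrom (toℕ k) (coeffs (solveFor R k nz))
solveFor-vanish R {k} e nz j k≤j = entry (j Fin.≟ k)
  where
    open ≡-Reasoning
    c⁻¹ : ℚ
    c⁻¹ = 1/_ (lookup (coeffs R) k) {{nz}}
    -R/c : Vec ℚ _
    -R/c = mapᵥ (- 1ℚ *_) (mapᵥ (c⁻¹ *_) (coeffs R))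

    entry : Dec (j ≡ k) → lookup (updateAt -R/c k (_+ 1ℚ)) j ≡ 0ℚ
    entry (yes refl) = begin
      lookup (updateAt -R/c k (_+ 1ℚ)) k           ≡⟨ lookup∘updateAt k -R/c ⟩
      lookup -R/c k + 1ℚ                            ≡⟨ cong (_+ 1ℚ) (negScale-entry c⁻¹ (coeffs R) k) ⟩
      - 1ℚ * (c⁻¹ * lookup (coeffs R) k) + 1ℚ       ≡⟨ cong (λ x → - 1ℚ * x + 1ℚ) (*-inverseˡ (lookup (coeffs R) k) {{nz}}) ⟩
      - 1ℚ * 1ℚ + 1ℚ                                ≡⟨⟩
      0ℚ                                            ∎
    entry (no j≢k) = begin
      lookup (updateAt -R/c k (_+ 1ℚ)) j           ≡⟨ lookup∘updateAt′ j k j≢k -R/c ⟩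
      lookup -R/c j                                 ≡⟨ negScale-entry c⁻¹ (coeffs R) j ⟩
      - 1ℚ * (c⁻¹ * lookup (coeffs R) j)            ≡⟨ cong (λ x → - 1ℚ * (c⁻¹ * x)) c_j≡0 ⟩
      - 1ℚ * (c⁻¹ * 0ℚ)                             ≡⟨ cong (- 1ℚ *_) (*-zeroʳ c⁻¹) ⟩
      - 1ℚ * 0ℚ                                     ≡⟨⟩
      0ℚ                                            ∎
      where
        c_j≡0 : lookup (coeffs R) j ≡ 0ℚ
        c_j≡0 = proj₂ (lead-just (coeffs R) e) j (ℕ.≤∧≢⇒< k≤j (λ q → j≢k (toℕ-injective (sym q))))

weight : ∀ {N} → List (Bound N) → ℕ
weight C = sum (map bdim C)

weight-↭ : ∀ {N} {C D : List (Bound N)} → C ↭ D → weight C ≡ weight D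
weight-↭ p = sum-↭ (map⁺ bdim p)

weight-++ : ∀ {N} (C D : List (Bound N)) → weight (C ++ D) ≡ weight C +ℕ weight D
weight-++ C D rewrite map-++ bdim C D = sum-++ (map bdim C) (map bdim D)

-- A collection of normalized bounds of total weight ≤ m: what the
-- normalization of a polynomial of dimension ≤ m produces.
NormalizedWithin : ∀ {N} → ℕ → List (Bound N) → Set
NormalizedWithin m L = All Normalized L × weight L ≤ℕ m

solved-within : ∀ {N} κ (R : Poly N) {m k} → VanishFrom m (coeffs R) → lead (coeffs R) ≡ just k →
                (nz : NonZero (lookup (coeffs R) k)) →
                NormalizedWithin m (bound k κ (solveFor R k nz) ∷ [])
solved-within κ R {m} {k} z e nz =
  s≤s (vanish⇒dim≤ (solveFor R _ nz) (solveFor-vanish R e nz)) ∷ [] ,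
  subst (_≤ℕ m) (sym (ℕ.+-identityʳ (suc (toℕ k)))) (lead<-vanish (coeffs R) z e)

normLt0-within : ∀ {N} c (R : Poly N) {m} → VanishFrom m (coeffs R) → NormalizedWithin m (normLt0 c R)
normLt0-within c R z with lead (coeffs R) in eq
... | nothing = [] , z≤n
... | just k with <-cmp (lookup (coeffs R) k) 0ℚ
...   | tri< ck<0 _ _ = solved-within (lower c) R z eq (<-nonZero ck<0)
...   | tri≈ _ _ _    = [] , z≤n
...   | tri> _ _ ck>0 = solved-within (upper c) R z eq (>-nonZero ck>0)

normEq0-within : ∀ {N} (R : Poly N) {m} → VanishFrom m (coeffs R) → NormalizedWithin m (normEq0 R)
normEq0-within R z with lead (coeffs R) in eq
... | nothing = [] , z≤n
... | just k with <-cmp (lookup (coeffs R) k) 0ℚ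
...   | tri< ck<0 _ _ = solved-within equal R z eq (<-nonZero ck<0)
...   | tri≈ _ _ _    = [] , z≤n
...   | tri> _ _ ck>0 = solved-within equal R z eq (>-nonZero ck>0)

comparison-within : ∀ {N} c (P Q : Poly N) {m} → dim P <ℕ suc m → dim Q <ℕ suc m →
                    NormalizedWithin m ⟨ P ⟦ c ⟧ Q ⟩
comparison-within c P Q dP dQ =
  normLt0-within c (P ⊖ Q) (vanish-⊖ P Q (dim≤⇒vanish P (s≤s⁻¹ dP)) (dim≤⇒vanish Q (s≤s⁻¹ dQ)))

equation-within : ∀ {N} (P Q : Poly N) {m} → dim P <ℕ suc m → dim Q <ℕ suc m →
                  NormalizedWithin m ⟨ P ≐ Q ⟩
equation-within P Q dP dQ =
  normEq0-within (P ⊖ Q) (vanish-⊖ P Q (dim≤⇒vanish P (s≤s⁻¹ dP)) (dim≤⇒vanish Q (s≤s⁻¹ dQ)))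

rule-within : ∀ {N} {v : Valuation N} {b₁ b₂ L} → Rule v b₁ b₂ L →
              Normalized b₁ → Normalized b₂ → NormalizedWithin (toℕ (var b₂)) L
rule-within (lt-int-1 {P = P} {Q} _)    n₁ n₂ = comparison-within le P Q n₁ n₂
rule-within (lt-int-2 {P = P} {Q} _)    n₁ n₂ = comparison-within le P Q n₁ n₂
rule-within (lt-int-3 {P = P} {Q} _)    n₁ n₂ = comparison-within lt P Q n₁ n₂
rule-within (lt-int-4 {P = P} {Q} _)    n₁ n₂ = comparison-within le P Q n₁ n₂
rule-within (gt-int-1 {P = P} {Q} _)    n₁ n₂ = comparison-within le Q P n₂ n₁
rule-within (gt-int-2 {P = P} {Q} _)    n₁ n₂ = comparison-within le Q P n₂ n₁
rule-within (gt-int-3 {P = P} {Q} _)    n₁ n₂ = comparison-within lt Q P n₂ n₁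
rule-within (gt-int-4 {P = P} {Q} _)    n₁ n₂ = comparison-within le Q P n₂ n₁
rule-within (eq-int-1 {P = P} {Q} {c})  n₁ n₂ = comparison-within c P Q n₁ n₂
rule-within (eq-int-2 {P = P} {Q} {c})  n₁ n₂ = comparison-within c Q P n₂ n₁
rule-within (eq-int-3 {P = P} {Q})      n₁ n₂ = equation-within P Q n₁ n₂

step-decreases : ∀ {N} {v : Valuation N} {C D} → D ◁[ v ] C → All Normalized C →
                 All Normalized D × weight D <ℕ weight C
step-decreases {C = C} (b₁ , b₂ , R , L , C↭ , rule , refl) nC
  with All-resp-↭ C↭ nC
... | n₁ ∷ n₂ ∷ nR with rule-within rule n₁ n₂
...   | nL , wL = n₁ ∷ ++⁺ nL nR , decrease
  where
    open ℕ.≤-Reasoning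
    decrease : weight (b₁ ∷ L ++ R) <ℕ weight C
    decrease = begin-strict
      bdim b₁ +ℕ weight (L ++ R)          ≡⟨ cong (bdim b₁ +ℕ_) (weight-++ L R) ⟩
      bdim b₁ +ℕ (weight L +ℕ weight R)   <⟨ ℕ.+-monoʳ-< (bdim b₁) (ℕ.+-monoˡ-< (weight R) (s≤s wL)) ⟩
      bdim b₁ +ℕ (bdim b₂ +ℕ weight R)    ≡⟨ weight-↭ C↭ ⟨
      weight C                            ∎

normalized-accessible : ∀ {N} (v : Valuation N) (C : List (Bound N)) →
                        Acc _<ℕ_ (weight C) → All Normalized C → Acc (_◁[ v ]_) C
normalized-accessible v C (acc smaller) nC = acc λ {D} step →
  let (nD , D<C) = step-decreases step nC
  in normalized-accessible v D (smaller D<C) nD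

lemma1 : (N : ℕ) (ty : VarTypes N) (v : Valuation N) → Consistent ty v →
         (C : List (Bound N)) → All Normalized C → All (Sat v) C →
         Acc (_◁[ v ]_) C
lemma1 N ty v _ C nC _ = normalized-accessible v C (<-wellFounded (weight C)) nC
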